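{- If $\sigma : \mathcal{S} \to \mathcal{A}$ is a $\sim$-strategy, then $\mathcal{S}$ has a coherent extension.
   Context: Setting: essps given by isomorphism families $\mathbb{S}_A$ (sets of bijections between configurations containing identities, closed under composition, inverse, restriction, and with the extension property), writing $x\cong_\theta y$ for $\theta\in\mathbb{S}_A$. A $\sim$-strategy $\sigma:\mathcal{S}\to\mathcal{A}$ is a map of essps that is courteous (if $s_1<s_2$ with nothing strictly in between and ${\it pol}(s_1)=+$ or ${\it pol}(s_2)=-$, then $\sigma s_1<\sigma s_2$ with nothing strictly in between), strong-receptive (every extension of $\sigma\theta$, $\theta\in\mathbb{S}_S$, by a pair of negative events $(a_1,a_2)$ within $\mathbb{S}_A$ lifts uniquely to an extension $\theta\cup\{(s_1,s_2)\}\in\mathbb{S}_S$ with $\sigma s_i=a_i$), and thin (if $\theta\in\mathbb{S}_S$ has two positive extensions $\theta_1,\theta_2\in\mathbb{S}_S$ whose domains have union in $\mathcal{C}(S)$, then $\theta_1\cup\theta_2\in\mathbb{S}_S$). An essp $\mathcal{A}$ has a coherent extension if for each $x\cong_\theta y$ and each $x\subseteq^+ x'\in\mathcal{C}(A)$ (extension by positive events) there is $y\subseteq^+ y'$ and $x'\cong_{\mathrm{ext}(\theta,x')} y'$ with $\theta\subseteq^+\mathrm{ext}(\theta,x')$, such that: (monotonicity) if $x_1\cong_\theta y_1$ and $x_1\subseteq^+x_2\subseteq^+x_3$ then $\mathrm{ext}(\mathrm{ext}(\theta,x_2),x_3)=\mathrm{ext}(\theta,x_3)$; (stability) if $x_1\cong_{\theta_1}y_1$,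 $\theta_1\subseteq^-\theta_2$ with $x_2\cong_{\theta_2}y_2$, and $x_1\subseteq^+x'_1$ with $\mathrm{ext}(\theta_1,x'_1)$ and $\theta_2$ compatible, then $\mathrm{ext}(\theta_1,x'_1)\subseteq\mathrm{ext}(\theta_2,x_2\cup x'_1)$. -}

module Defs where

open import Level using (Level; _⊔_) renaming (suc to lsuc; zero to lzero)
open import Data.Product using (Σ; ∃; _×_; _,_)
open import Data.Sum using (_⊎_)
open import Data.Empty using (⊥)
open import Data.List using (List)
open import Data.List.Membership.Propositional using (_∈_)
open import Relation.Nullary using (¬_)
open import Relation.Binary.PropositionalEquality using (_≡_; _≢_)

data Pol : Set where
  plus minus : Pol

Pred : Set → Set₁
Pred E = E → Set

BRel : Set → Set₁
BRel E = E → E → Set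

module _ {E : Set} where

  _⊆ₚ_ : Pred E → Pred E → Set
  x ⊆ₚ y = ∀ e → x e → y e

  _≐ₚ_ : Pred E → Pred E → Set
  x ≐ₚ y = x ⊆ₚ y × y ⊆ₚ x

  _∪ₚ_ : Pred E → Pred E → Pred E
  (x ∪ₚ y) e = x e ⊎ y e

  Finite : Pred E → Set
  Finite x = Σ (List E) λ l → ∀ e → (x e → e ∈ l) × (e ∈ l → x e)

  _⊆ᵣ_ : BRel E → BRel E → Set
  θ ⊆ᵣ θ' = ∀ a b → θ a b → θ' a b

  _≐ᵣ_ : BRel E → BRel E → Set
  θ ≐ᵣ θ' = θ ⊆ᵣ θ' × θ' ⊆ᵣ θ

  _∪ᵣ_ : BRel E → BRel E → BRel E
  (θ ∪ᵣ θ') a b = θ a b ⊎ θ' a b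

  _∪⟨_,_⟩ : BRel E → E → E → BRel E
  (θ ∪⟨ a₁ , a₂ ⟩) a b = θ a b ⊎ (a ≡ a₁ × b ≡ a₂)

  dom : BRel E → Pred E
  dom θ a = ∃ λ b → θ a b

  cod : BRel E → Pred E
  cod θ b = ∃ λ a → θ a b

  idR : Pred E → BRel E
  idR x a b = x a × a ≡ b

  invR : BRel E → BRel E
  invR θ a b = θ b a

  _⨾_ : BRel E → BRel E → BRel E
  (θ ⨾ φ) a c = ∃ λ b → θ a b × φ b c

  restr : BRel E → Pred E → BRel E
  restr θ x a b = x a × θ a b

  IsBij : BRel E → Set
  IsBij θ = (∀ a b b' → θ a b → θ a b' → b ≡ b')
          × (∀ a a' b → θ a b → θ a' b → a ≡ a')

record ESP : Set₁ where
  field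
    E     : Set
    _≤_   : E → E → Set
    ≤-refl    : ∀ e → e ≤ e
    ≤-trans   : ∀ e e' e'' → e ≤ e' → e' ≤ e'' → e ≤ e''
    ≤-antisym : ∀ e e' → e ≤ e' → e' ≤ e → e ≡ e'
    finite-causes : ∀ e → Finite (λ e' → e' ≤ e)
    _#_   : E → E → Set
    #-irrefl : ∀ e → ¬ (e # e)
    #-sym    : ∀ e e' → e # e' → e' # e
    #-hered  : ∀ e e' e'' → e # e' → e' ≤ e'' → e # e''
    pol   : E → Pol

  _<_ : E → E → Set
  e < e' = e ≤ e' × e ≢ e'

  _⋖_ : E → E → Set
  e ⋖ e' = e < e' × (∀ t → e < t → t < e' → ⊥)

  IsConfig : Pred E → Set
  IsConfig x = Finite x
             × (∀ e e' → e' ≤ e → x e → x e')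
             × (∀ e e' → x e → x e' → ¬ (e # e'))

  IsIso : BRel E → Set
  IsIso θ = IsBij θ × IsConfig (dom θ) × IsConfig (cod θ)

  _⊆⁺_ : Pred E → Pred E → Set
  x ⊆⁺ x' = x ⊆ₚ x' × (∀ e → x' e → ¬ x e → pol e ≡ plus)

  _⊆⁺ᵣ_ : BRel E → BRel E → Set
  θ ⊆⁺ᵣ θ' = θ ⊆ᵣ θ' × (∀ a b → θ' a b → ¬ θ a b → pol a ≡ plus × pol b ≡ plus)

  _⊆⁻ᵣ_ : BRel E → BRel E → Set
  θ ⊆⁻ᵣ θ' = θ ⊆ᵣ θ' × (∀ a b → θ' a b → ¬ θ a b → pol a ≡ minus × pol b ≡ minus)

record ESSP : Set₂ where
  field
    esp : ESP
  open ESP esp public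
  field
    𝕊 : BRel E → Set
    𝕊-resp   : ∀ θ θ' → θ ≐ᵣ θ' → 𝕊 θ → 𝕊 θ'
    𝕊-iso    : ∀ θ → 𝕊 θ → IsIso θ
    𝕊-pol    : ∀ θ a b → 𝕊 θ → θ a b → pol a ≡ pol b
    𝕊-id     : ∀ x → IsConfig x → 𝕊 (idR x)
    𝕊-comp   : ∀ θ φ → 𝕊 θ → 𝕊 φ → cod θ ≐ₚ dom φ → 𝕊 (θ ⨾ φ)
    𝕊-inv    : ∀ θ → 𝕊 θ → 𝕊 (invR θ)
    𝕊-restr  : ∀ θ x → 𝕊 θ → IsConfig x → x ⊆ₚ dom θ → 𝕊 (restr θ x)
    𝕊-extend : ∀ θ x' → 𝕊 θ → IsConfig x' → dom θ ⊆ₚ x' →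
               Σ (BRel E) λ θ' → 𝕊 θ' × θ ⊆ᵣ θ' × dom θ' ≐ₚ x'

module _ (S A : ESSP) where
  private
    module S = ESSP S
    module A = ESSP A

  imgₚ : (S.E → A.E) → Pred S.E → Pred A.E
  imgₚ f x a = ∃ λ s → x s × f s ≡ a

  imgᵣ : (S.E → A.E) → BRel S.E → BRel A.E
  imgᵣ f θ a b = ∃ λ s₁ → ∃ λ s₂ → θ s₁ s₂ × f s₁ ≡ a × f s₂ ≡ b

  record Map : Set₁ where
    field
      fun      : S.E → A.E
      pres-cfg : ∀ x → S.IsConfig x → A.IsConfig (imgₚ fun x)
      loc-inj  : ∀ x s s' → S.IsConfig x → x s → x s' → fun s ≡ fun s' → s ≡ s'
      pres-pol : ∀ s → A.pol (fun s) ≡ S.pol s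
      pres-𝕊   : ∀ θ → S.𝕊 θ → A.𝕊 (imgᵣ fun θ)

  record Strategy : Set₁ where
    field
      σ : Map
    open Map σ
    field
      courteous : ∀ s₁ s₂ → s₁ S.⋖ s₂ → (S.pol s₁ ≡ plus ⊎ S.pol s₂ ≡ minus) →
                  fun s₁ A.⋖ fun s₂
      strong-receptive :
        ∀ θ a₁ a₂ → S.𝕊 θ →
        A.pol a₁ ≡ minus → A.pol a₂ ≡ minus →
        ¬ dom (imgᵣ fun θ) a₁ →
        A.𝕊 (imgᵣ fun θ ∪⟨ a₁ , a₂ ⟩) →
        Σ S.E λ s₁ → Σ S.E λ s₂ →
          (¬ dom θ s₁ × S.𝕊 (θ ∪⟨ s₁ , s₂ ⟩) × fun s₁ ≡ a₁ × fun s₂ ≡ a₂)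
          × (∀ t₁ t₂ → ¬ dom θ t₁ → S.𝕊 (θ ∪⟨ t₁ , t₂ ⟩) →
               fun t₁ ≡ a₁ → fun t₂ ≡ a₂ → t₁ ≡ s₁ × t₂ ≡ s₂)
      thin : ∀ θ θ₁ θ₂ → S.𝕊 θ → S.𝕊 θ₁ → S.𝕊 θ₂ →
             θ S.⊆⁺ᵣ θ₁ → θ S.⊆⁺ᵣ θ₂ →
             S.IsConfig (dom θ₁ ∪ₚ dom θ₂) →
             S.𝕊 (θ₁ ∪ᵣ θ₂)

record CoherentExtension (A : ESSP) : Set₁ where
  open ESSP A
  field
    ext : ∀ (θ : BRel E) → 𝕊 θ → (x' : Pred E) → IsConfig x' → dom θ ⊆⁺ x' → BRel E
    ext-𝕊   : ∀ θ h x' c p → 𝕊 (ext θ h x' c p)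
    ext-dom : ∀ θ h x' c p → dom (ext θ h x' c p) ≐ₚ x'
    ext-pos : ∀ θ h x' c p → θ ⊆⁺ᵣ ext θ h x' c p
    -- ext is a function of the sets θ and x' (not of proofs / representations)
    ext-wd  : ∀ θ θ' h h' x x' c c' p p' → θ ≐ᵣ θ' → x ≐ₚ x' →
              ext θ h x c p ≐ᵣ ext θ' h' x' c' p'
    monotone : ∀ θ h x₂ c₂ (p₂ : dom θ ⊆⁺ x₂) x₃ c₃ → x₂ ⊆⁺ x₃ →
               ∀ h' p p₃ →
               ext (ext θ h x₂ c₂ p₂) h' x₃ c₃ p ≐ᵣ ext θ h x₃ c₃ p₃
    stable : ∀ θ₁ h₁ θ₂ h₂ → θ₁ ⊆⁻ᵣ θ₂ →
             ∀ x₁' c₁ (p₁ : dom θ₁ ⊆⁺ x₁') →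
             𝕊 (ext θ₁ h₁ x₁' c₁ p₁ ∪ᵣ θ₂) →
             ∀ c p →
             ext θ₁ h₁ x₁' c₁ p₁ ⊆ᵣ ext θ₂ h₂ (dom θ₂ ∪ₚ x₁') c p

-- Thinness makes positive extensions unique: two positive extensions θ₁, θ₂ of θ
-- with the same domain have a union in 𝕊, which is a bijection, so θ₁ = θ₂.
-- Hence any choice of extension via the extension axiom is automatically
-- well defined, monotone and stable.
module Submission where

open import Defs
open import Data.Product using (_×_; _,_; proj₁; proj₂)
open import Data.Sum using (inj₁; inj₂)
open import Data.Empty using (⊥-elim)
open import Relation.Nullary using (¬_)
open import Function using (_∘_)
open import Relation.Binary.PropositionalEquality using (_≡_; refl; sym; trans; subst)

plus-stable : {p : Pol} → ¬ ¬ (p ≡ plus) → p ≡ plus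
plus-stable {plus}  _    = refl
plus-stable {minus} ¬¬p+ = ⊥-elim (¬¬p+ λ ())

module _ {E : Set} where

  ≐ₚ-sym : {x y : Pred E} → x ≐ₚ y → y ≐ₚ x
  ≐ₚ-sym (x⊆y , y⊆x) = y⊆x , x⊆y

  ≐ₚ-trans : {x y z : Pred E} → x ≐ₚ y → y ≐ₚ z → x ≐ₚ z
  ≐ₚ-trans (x⊆y , y⊆x) (y⊆z , z⊆y) = (λ e → y⊆z e ∘ x⊆y e) , (λ e → y⊆x e ∘ z⊆y e)

Thin : ESSP → Set₁
Thin S = ∀ θ θ₁ θ₂ → 𝕊 θ → 𝕊 θ₁ → 𝕊 θ₂ → θ ⊆⁺ᵣ θ₁ → θ ⊆⁺ᵣ θ₂ →
         IsConfig (dom θ₁ ∪ₚ dom θ₂) → 𝕊 (θ₁ ∪ᵣ θ₂)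
  where open ESSP S

module Symmetry (S : ESSP) where
  open ESSP S

  IsConfig-resp : ∀ {x y} → x ≐ₚ y → IsConfig x → IsConfig y
  IsConfig-resp (x⊆y , y⊆x) ((l , enum) , down , consistent) =
      (l , λ e → (λ ye → proj₁ (enum e) (y⊆x e ye)) , (λ e∈l → x⊆y e (proj₂ (enum e) e∈l)))
    , (λ e e' e'≤e ye → x⊆y e' (down e e' e'≤e (y⊆x e ye)))
    , (λ e e' ye ye' → consistent e e' (y⊆x e ye) (y⊆x e' ye'))

  -- In a bijection θ' ⊇ θ, a pair outside θ has its left event outside dom θ;
  -- as dom θ need not be decidable, this is only known up to double negation.
  ⊆⁺ᵣ-from-dom : ∀ {θ θ'} → 𝕊 θ' → θ ⊆ᵣ θ' →
                 (∀ e → dom θ' e → ¬ dom θ e → pol e ≡ plus) → θ ⊆⁺ᵣ θ'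
  ⊆⁺ᵣ-from-dom {θ} {θ'} θ'∈𝕊 θ⊆θ' new-plus = θ⊆θ' , new-pairs-plus
    where
    new-pairs-plus : ∀ a b → θ' a b → ¬ θ a b → pol a ≡ plus × pol b ≡ plus
    new-pairs-plus a b θ'ab ¬θab = pol-a , trans (sym (𝕊-pol θ' a b θ'∈𝕊 θ'ab)) pol-a
      where
      functional = proj₁ (proj₁ (𝕊-iso θ' θ'∈𝕊))
      a∉dom : ¬ dom θ a
      a∉dom (b' , θab') = ¬θab (subst (θ a) (functional a b' b (θ⊆θ' a b' θab') θ'ab) θab')
      pol-a : pol a ≡ plus
      pol-a = plus-stable λ ¬plus → ¬plus (new-plus a (b , θ'ab) a∉dom)

  ⊆⁺ᵣ-trans : ∀ {θ θ' θ''} → 𝕊 θ'' → θ ⊆⁺ᵣ θ' → θ' ⊆⁺ᵣ θ'' → θ ⊆⁺ᵣ θ''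
  ⊆⁺ᵣ-trans {θ} {θ'} {θ''} θ''∈𝕊 (θ⊆θ' , new₁) (θ'⊆θ'' , new₂) =
    (λ a b → θ'⊆θ'' a b ∘ θ⊆θ' a b) , new-pairs-plus
    where
    new-pairs-plus : ∀ a b → θ'' a b → ¬ θ a b → pol a ≡ plus × pol b ≡ plus
    new-pairs-plus a b θ''ab ¬θab = pol-a , trans (sym (𝕊-pol θ'' a b θ''∈𝕊 θ''ab)) pol-a
      where
      pol-a : pol a ≡ plus
      pol-a = plus-stable λ ¬plus →
        (λ ¬θ'ab → ¬plus (proj₁ (new₂ a b θ''ab ¬θ'ab)))
        (λ θ'ab → ¬plus (proj₁ (new₁ a b θ'ab ¬θab)))

  ⊆⁺ᵣ-respˡ : ∀ {θ θ' φ} → θ ≐ᵣ θ' → θ' ⊆⁺ᵣ φ → θ ⊆⁺ᵣ φ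
  ⊆⁺ᵣ-respˡ (θ⊆θ' , θ'⊆θ) (θ'⊆φ , new) =
    (λ a b θab → θ'⊆φ a b (θ⊆θ' a b θab)) ,
    (λ a b φab ¬θab → new a b φab (λ θ'ab → ¬θab (θ'⊆θ a b θ'ab)))

module ThinExtension (S : ESSP) (thin : Thin S) where
  open ESSP S
  open Symmetry S

  positive-extension-unique :
    ∀ θ θ₁ θ₂ → 𝕊 θ → 𝕊 θ₁ → 𝕊 θ₂ → θ ⊆⁺ᵣ θ₁ → θ ⊆⁺ᵣ θ₂ →
    IsConfig (dom θ₁) → dom θ₁ ≐ₚ dom θ₂ → θ₁ ⊆ᵣ θ₂
  positive-extension-unique θ θ₁ θ₂ θ∈𝕊 θ₁∈𝕊 θ₂∈𝕊 θ⊆⁺θ₁ θ⊆⁺θ₂ dom₁-cfg (d₁⊆d₂ , d₂⊆d₁)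
                            a b θ₁ab with d₁⊆d₂ a (b , θ₁ab)
  ... | b' , θ₂ab' = subst (θ₂ a) (sym (functional a b b' (inj₁ θ₁ab) (inj₂ θ₂ab'))) θ₂ab'
    where
    union-cfg : IsConfig (dom θ₁ ∪ₚ dom θ₂)
    union-cfg = IsConfig-resp ((λ _ → inj₁) , λ { e (inj₁ d) → d ; e (inj₂ d) → d₂⊆d₁ e d }) dom₁-cfg
    functional = proj₁ (proj₁ (𝕊-iso _ (thin θ θ₁ θ₂ θ∈𝕊 θ₁∈𝕊 θ₂∈𝕊 θ⊆⁺θ₁ θ⊆⁺θ₂ union-cfg)))

  positive-extension-unique-≐ :
    ∀ θ θ₁ θ₂ → 𝕊 θ → 𝕊 θ₁ → 𝕊 θ₂ → θ ⊆⁺ᵣ θ₁ → θ ⊆⁺ᵣ θ₂ →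
    IsConfig (dom θ₁) → dom θ₁ ≐ₚ dom θ₂ → θ₁ ≐ᵣ θ₂
  positive-extension-unique-≐ θ θ₁ θ₂ θ∈𝕊 θ₁∈𝕊 θ₂∈𝕊 θ⊆⁺θ₁ θ⊆⁺θ₂ dom₁-cfg d₁≐d₂ =
      positive-extension-unique θ θ₁ θ₂ θ∈𝕊 θ₁∈𝕊 θ₂∈𝕊 θ⊆⁺θ₁ θ⊆⁺θ₂ dom₁-cfg d₁≐d₂
    , positive-extension-unique θ θ₂ θ₁ θ∈𝕊 θ₂∈𝕊 θ₁∈𝕊 θ⊆⁺θ₂ θ⊆⁺θ₁
        (IsConfig-resp d₁≐d₂ dom₁-cfg) (≐ₚ-sym d₁≐d₂)

  module _ (θ : BRel E) (θ∈𝕊 : 𝕊 θ) (x' : Pred E) (x'-cfg : IsConfig x') (p : dom θ ⊆⁺ x') where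

    private
      extension = 𝕊-extend θ x' θ∈𝕊 x'-cfg (proj₁ p)

    ext : BRel E
    ext = proj₁ extension

    ext-𝕊 : 𝕊 ext
    ext-𝕊 = proj₁ (proj₂ extension)

    ext-dom : dom ext ≐ₚ x'
    ext-dom = proj₂ (proj₂ (proj₂ extension))

    ext-cfg : IsConfig (dom ext)
    ext-cfg = IsConfig-resp (≐ₚ-sym ext-dom) x'-cfg

    ext-⊇ : θ ⊆ᵣ ext
    ext-⊇ = proj₁ (proj₂ (proj₂ extension))

    ext-pos : θ ⊆⁺ᵣ ext
    ext-pos = ⊆⁺ᵣ-from-dom ext-𝕊 ext-⊇
                (λ e d → proj₂ p e (proj₁ ext-dom e d))

  ext-wd : ∀ θ θ' h h' x x' c c' p p' → θ ≐ᵣ θ' → x ≐ₚ x' →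
           ext θ h x c p ≐ᵣ ext θ' h' x' c' p'
  ext-wd θ θ' h h' x x' c c' p p' θ≐θ' x≐x' =
    positive-extension-unique-≐ θ _ _ h (ext-𝕊 θ h x c p) (ext-𝕊 θ' h' x' c' p')
      (ext-pos θ h x c p) (⊆⁺ᵣ-respˡ θ≐θ' (ext-pos θ' h' x' c' p'))
      (ext-cfg θ h x c p)
      (≐ₚ-trans (ext-dom θ h x c p) (≐ₚ-trans x≐x' (≐ₚ-sym (ext-dom θ' h' x' c' p'))))

  monotone : ∀ θ h x₂ c₂ (p₂ : dom θ ⊆⁺ x₂) x₃ c₃ → x₂ ⊆⁺ x₃ →
             ∀ h' p p₃ →
             ext (ext θ h x₂ c₂ p₂) h' x₃ c₃ p ≐ᵣ ext θ h x₃ c₃ p₃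
  monotone θ h x₂ c₂ p₂ x₃ c₃ _ h' p p₃ =
    positive-extension-unique-≐ θ _ _ h (ext-𝕊 _ h' x₃ c₃ p) (ext-𝕊 θ h x₃ c₃ p₃)
      (⊆⁺ᵣ-trans (ext-𝕊 _ h' x₃ c₃ p) (ext-pos θ h x₂ c₂ p₂) (ext-pos _ h' x₃ c₃ p))
      (ext-pos θ h x₃ c₃ p₃)
      (ext-cfg _ h' x₃ c₃ p)
      (≐ₚ-trans (ext-dom _ h' x₃ c₃ p) (≐ₚ-sym (ext-dom θ h x₃ c₃ p₃)))

  -- ext(θ₁,x₁') ∪ θ₂ is itself a positive extension of θ₂ with domain dom θ₂ ∪ x₁'.
  stable : ∀ θ₁ h₁ θ₂ h₂ → θ₁ ⊆⁻ᵣ θ₂ →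
           ∀ x₁' c₁ (p₁ : dom θ₁ ⊆⁺ x₁') →
           𝕊 (ext θ₁ h₁ x₁' c₁ p₁ ∪ᵣ θ₂) →
           ∀ c p →
           ext θ₁ h₁ x₁' c₁ p₁ ⊆ᵣ ext θ₂ h₂ (dom θ₂ ∪ₚ x₁') c p
  stable θ₁ h₁ θ₂ h₂ (θ₁⊆θ₂ , _) x₁' c₁ p₁ ψ∈𝕊 c p a b ext₁ab =
    positive-extension-unique θ₂ ψ _ h₂ ψ∈𝕊 (ext-𝕊 θ₂ h₂ _ c p) θ₂⊆⁺ψ (ext-pos θ₂ h₂ _ c p)
      (IsConfig-resp (≐ₚ-sym dom-ψ) c)
      (≐ₚ-trans dom-ψ (≐ₚ-sym (ext-dom θ₂ h₂ _ c p))) a b (inj₁ ext₁ab)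
    where
    ext₁ = ext θ₁ h₁ x₁' c₁ p₁
    ψ = ext₁ ∪ᵣ θ₂
    θ₂⊆⁺ψ : θ₂ ⊆⁺ᵣ ψ
    θ₂⊆⁺ψ = (λ _ _ → inj₂)
          , λ { a b (inj₁ ext₁ab) ¬θ₂ab →
                  proj₂ (ext-pos θ₁ h₁ x₁' c₁ p₁) a b ext₁ab (λ θ₁ab → ¬θ₂ab (θ₁⊆θ₂ a b θ₁ab))
              ; a b (inj₂ t) ¬θ₂ab → ⊥-elim (¬θ₂ab t) }
    dom-ψ : dom ψ ≐ₚ (dom θ₂ ∪ₚ x₁')
    dom-ψ with ext-dom θ₁ h₁ x₁' c₁ p₁
    ... | d⊆x , x⊆d =
        (λ { e (b , inj₁ t) → inj₂ (d⊆x e (b , t)) ; e (b , inj₂ t) → inj₁ (b , t) })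
      , (λ { e (inj₁ (b , t)) → b , inj₂ t
           ; e (inj₂ x₁'e) → let (b , t) = x⊆d e x₁'e in b , inj₁ t })

thin⇒coherentExtension : (S : ESSP) → Thin S → CoherentExtension S
thin⇒coherentExtension S thin = record
  { ext = ext ; ext-𝕊 = ext-𝕊 ; ext-dom = ext-dom ; ext-pos = ext-pos
  ; ext-wd = ext-wd ; monotone = monotone ; stable = stable }
  where open ThinExtension S thin

lemma7 : (S A : ESSP) → Strategy S A → CoherentExtension S
lemma7 S A σ = thin⇒coherentExtension S (Strategy.thin σ)
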